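{- Let $E$ be a propositional variable and $\delta$ a new atomic formula symbol. Then $\mathsf{QLP}^-(\delta\leftrightarrow[E\wedge\neg(\exists x)x:(\delta\rightarrow E)])_{\emptyset}\nvdash\neg\delta$, where this logic is $\mathsf{QLP}^-$ without Axiom Necessitation, over the language extended by $\delta$, with the single additional axiom $\delta\leftrightarrow[E\wedge\neg(\exists x)x:(\delta\rightarrow E)]$.
   Context: Fix countably many justification variables, propositional variables, and primitive function symbols of each arity $n\ge0$; a primitive term is $f(x_1,\dots,x_n)$. Terms of $\mathsf{QLP}^-$: $t::= x\mid f(x_1,\dots,x_n)\mid t\cdot t\mid t+t\mid !t$. Formulas: $A::= p\mid\bot\mid\neg A\mid A\wedge A\mid A\vee A\mid A\rightarrow A\mid t:A\mid(\forall x)A\mid(\exists x)A$. Axioms: all propositional tautologies; Q1: $(\forall x)A(x)\rightarrow A(t)$, $t$ free for $x$; Q2: $(\forall x)(A\rightarrow B(x))\rightarrow(A\rightarrow(\forall x)B(x))$, $x$ not free in $A$; Q3: $A(t)\rightarrow(\exists x)A(x)$, $t$ free for $x$; Q4: $(\forall x)(A(x)\rightarrow B)\rightarrow((\exists x)A(x)\rightarrow B)$, $x$ not free in $B$; jK: $s:(A\rightarrow B)\rightarrow(t:A\rightarrow(s\cdot t):B)$; jT: $t:A\rightarrow A$; j4: $t:A\rightarrow !t:t:A$; Sum: $s:A\rightarrow(s+t):A$, $s:A\rightarrow(t+s):A$. Rules: Modus Ponens; Gen: from $A$ infer $(\forall x)A$; Axiom Necessitation: from an axiom instance $A$ infer $f(x_1,\dots,x_n):A$.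 The subscript $\emptyset$ means Axiom Necessitation is dropped. All schemes and rules apply to formulas of the extended language. -}

module Defs where

open import Data.Nat using (ℕ; _≡ᵇ_)
open import Data.Bool using (Bool; true; false; _∧_; _∨_; not; if_then_else_)
open import Data.Maybe using (Maybe; just; nothing; map)
open import Data.Vec using (Vec)
import Data.Vec as V
open import Relation.Binary.PropositionalEquality using (_≡_)

-- Justification variables are natural numbers.
-- Primitive function symbols: symbol number i of arity n, applied to n variables.
data Term : Set where
  var  : ℕ → Term
  prim : (n : ℕ) → (i : ℕ) → Vec ℕ n → Term
  _·_  : Term → Term → Term
  _⊕_  : Term → Term → Term
  !_   : Term → Term

infixr 5 _⇒_
data Form : Set where
  pv   : ℕ → Form
  δ    : Form
  ⊥'   : Form
  ¬'_  : Form → Form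
  _∧'_ : Form → Form → Form
  _∨'_ : Form → Form → Form
  _⇒_  : Form → Form → Form
  _∶_  : Term → Form → Form
  ∀'   : ℕ → Form → Form
  ∃'   : ℕ → Form → Form

_⇔_ : Form → Form → Form
A ⇔ B = (A ⇒ B) ∧' (B ⇒ A)

-- Propositional tautologies: true under every valuation of the prime
-- (propositionally atomic) formulas p, δ, t:A, (∀x)A, (∃x)A.

eval : (Form → Bool) → Form → Bool
eval v ⊥'        = false
eval v (¬' A)    = not (eval v A)
eval v (A ∧' B)  = eval v A ∧ eval v B
eval v (A ∨' B)  = eval v A ∨ eval v B
eval v (A ⇒ B)   = not (eval v A) ∨ eval v B
eval v A         = v A

Tautology : Form → Set
Tautology A = (v : Form → Bool) → eval v A ≡ true

anyVec : ∀ {n} → (ℕ → Bool) → Vec ℕ n → Bool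
anyVec p V.[] = false
anyVec p (y V.∷ ys) = p y ∨ anyVec p ys

occursT : ℕ → Term → Bool
occursT x (var y) = x ≡ᵇ y
occursT x (prim n i ys) = anyVec (x ≡ᵇ_) ys
occursT x (s · t) = occursT x s ∨ occursT x t
occursT x (s ⊕ t) = occursT x s ∨ occursT x t
occursT x (! t) = occursT x t

freeIn : ℕ → Form → Bool
freeIn x (pv _) = false
freeIn x δ = false
freeIn x ⊥' = false
freeIn x (¬' A) = freeIn x A
freeIn x (A ∧' B) = freeIn x A ∨ freeIn x B
freeIn x (A ∨' B) = freeIn x A ∨ freeIn x B
freeIn x (A ⇒ B) = freeIn x A ∨ freeIn x B
freeIn x (t ∶ A) = occursT x t ∨ freeIn x A
freeIn x (∀' y A) = not (x ≡ᵇ y) ∧ freeIn x A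
freeIn x (∃' y A) = not (x ≡ᵇ y) ∧ freeIn x A

freeFor : Term → ℕ → Form → Bool
freeFor t x (pv _) = true
freeFor t x δ = true
freeFor t x ⊥' = true
freeFor t x (¬' A) = freeFor t x A
freeFor t x (A ∧' B) = freeFor t x A ∧ freeFor t x B
freeFor t x (A ∨' B) = freeFor t x A ∧ freeFor t x B
freeFor t x (A ⇒ B) = freeFor t x A ∧ freeFor t x B
freeFor t x (s ∶ A) = freeFor t x A
freeFor t x (∀' y A) =
  if x ≡ᵇ y then true
  else (if freeIn x A then not (occursT y t) ∧ freeFor t x A else true)
freeFor t x (∃' y A) =
  if x ≡ᵇ y then true
  else (if freeIn x A then not (occursT y t) ∧ freeFor t x A else true)

-- It is partial:
-- a primitive term f(x1,...,xn) only takes variables as arguments, so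
-- replacing an argument x by a non-variable term yields no term.
substT : Term → ℕ → Term → Maybe Term
substT t x (var y) = if x ≡ᵇ y then just t else just (var y)
substT (var z) x (prim n i ys) =
  just (prim n i (V.map (λ y → if x ≡ᵇ y then z else y) ys))
substT t x (prim n i ys) =
  if anyVec (x ≡ᵇ_) ys then nothing else just (prim n i ys)
substT t x (s₁ · s₂) with substT t x s₁ | substT t x s₂
... | just a | just b = just (a · b)
... | _ | _ = nothing
substT t x (s₁ ⊕ s₂) with substT t x s₁ | substT t x s₂
... | just a | just b = just (a ⊕ b)
... | _ | _ = nothing
substT t x (! s) = map !_ (substT t x s)

-- Substitution of t for the free occurrences of x in A (partial, as above;
-- capture is excluded separately by freeFor).
subst : Term → ℕ → Form → Maybe Form
subst t x (pv p) = just (pv p)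
subst t x δ = just δ
subst t x ⊥' = just ⊥'
subst t x (¬' A) = map ¬'_ (subst t x A)
subst t x (A ∧' B) with subst t x A | subst t x B
... | just a | just b = just (a ∧' b)
... | _ | _ = nothing
subst t x (A ∨' B) with subst t x A | subst t x B
... | just a | just b = just (a ∨' b)
... | _ | _ = nothing
subst t x (A ⇒ B) with subst t x A | subst t x B
... | just a | just b = just (a ⇒ b)
... | _ | _ = nothing
subst t x (s ∶ A) with substT t x s | subst t x A
... | just a | just b = just (a ∶ b)
... | _ | _ = nothing
subst t x (∀' y A) = if x ≡ᵇ y then just (∀' y A) else map (∀' y) (subst t x A)
subst t x (∃' y A) = if x ≡ᵇ y then just (∃' y A) else map (∃' y) (subst t x A)

data Axiom : Form → Set where
  taut : ∀ {A} → Tautology A → Axiom A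
  Q1 : ∀ {x A t B} → freeFor t x A ≡ true → subst t x A ≡ just B →
       Axiom (∀' x A ⇒ B)
  Q2 : ∀ {x A B} → freeIn x A ≡ false →
       Axiom (∀' x (A ⇒ B) ⇒ (A ⇒ ∀' x B))
  Q3 : ∀ {x A t B} → freeFor t x A ≡ true → subst t x A ≡ just B →
       Axiom (B ⇒ ∃' x A)
  Q4 : ∀ {x A B} → freeIn x B ≡ false →
       Axiom (∀' x (A ⇒ B) ⇒ (∃' x A ⇒ B))
  jK : ∀ {s t A B} → Axiom ((s ∶ (A ⇒ B)) ⇒ ((t ∶ A) ⇒ ((s · t) ∶ B)))
  jT : ∀ {t A} → Axiom ((t ∶ A) ⇒ A)
  j4 : ∀ {t A} → Axiom ((t ∶ A) ⇒ ((! t) ∶ (t ∶ A)))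
  sumL : ∀ {s t A} → Axiom ((s ∶ A) ⇒ ((s ⊕ t) ∶ A))
  sumR : ∀ {s t A} → Axiom ((s ∶ A) ⇒ ((t ⊕ s) ∶ A))

deltaAxiom : ℕ → ℕ → Form
deltaAxiom e x = δ ⇔ (pv e ∧' (¬' ∃' x (var x ∶ (δ ⇒ pv e))))

-- Derivability in QLP⁻(δ ↔ [...])_∅ : no Axiom Necessitation.
data Prov (e x : ℕ) : Form → Set where
  ax    : ∀ {A} → Axiom A → Prov e x A
  extra : Prov e x (deltaAxiom e x)
  mp    : ∀ {A B} → Prov e x (A ⇒ B) → Prov e x A → Prov e x B
  gen   : ∀ {A} (y : ℕ) → Prov e x A → Prov e x (∀' y A)

module Submission where

-- We give a soundness argument for a "forgetful"
-- Boolean semantics in which every justification assertion t:A is false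
-- and the quantifiers are erased ((∀x)A and (∃x)A mean A).  Propositional
-- variables and δ receive arbitrary truth values.  Under this semantics
--   * the interpretation of compound formulas is a Boolean valuation of
--     the prime formulas, so every tautology is true;
--   * substituting a term into a formula does not change its value, so
--     Q1-Q4 are true; jK, jT, j4 and Sum are true since their premises
--     t:A are false;
--   * modus ponens and generalisation preserve truth;
--   * the extra axiom reduces to δ ↔ E (because (∃x)x:(δ → E) is false),
--     which holds as soon as δ and E get the same value.
-- Hence every theorem of QLP⁻(δ ↔ [...])_∅ is true when δ and E are both
-- true, whereas ¬δ is then false; so ¬δ is not derivable.

open import Defs
open import Data.Nat using (ℕ; _≡ᵇ_)
open import Data.Bool using (Bool; true; false; _∧_; _∨_; not)
open import Data.Bool.Properties using (∨-inverseˡ)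
open import Data.Maybe using (just)
open import Relation.Nullary using (¬_)
open import Relation.Binary.PropositionalEquality using (_≡_; refl; cong; cong₂; sym; trans)

module Forgetful (ρ : ℕ → Bool) (d : Bool) where

  ⟦_⟧ : Form → Bool
  ⟦ pv p ⟧     = ρ p
  ⟦ δ ⟧        = d
  ⟦ ⊥' ⟧       = false
  ⟦ ¬' A ⟧     = not ⟦ A ⟧
  ⟦ A ∧' B ⟧   = ⟦ A ⟧ ∧ ⟦ B ⟧
  ⟦ A ∨' B ⟧   = ⟦ A ⟧ ∨ ⟦ B ⟧
  ⟦ A ⇒ B ⟧    = not ⟦ A ⟧ ∨ ⟦ B ⟧
  ⟦ _ ∶ _ ⟧    = false
  ⟦ ∀' _ A ⟧   = ⟦ A ⟧
  ⟦ ∃' _ A ⟧   = ⟦ A ⟧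

  -- ⟦_⟧ is the propositional evaluation induced by its own values on the
  -- prime formulas; hence every tautology is true under ⟦_⟧.
  eval-⟦⟧ : ∀ A → eval ⟦_⟧ A ≡ ⟦ A ⟧
  eval-⟦⟧ (pv _)    = refl
  eval-⟦⟧ δ         = refl
  eval-⟦⟧ ⊥'        = refl
  eval-⟦⟧ (¬' A)    = cong not (eval-⟦⟧ A)
  eval-⟦⟧ (A ∧' B)  = cong₂ _∧_ (eval-⟦⟧ A) (eval-⟦⟧ B)
  eval-⟦⟧ (A ∨' B)  = cong₂ _∨_ (eval-⟦⟧ A) (eval-⟦⟧ B)
  eval-⟦⟧ (A ⇒ B)   = cong₂ (λ a b → not a ∨ b) (eval-⟦⟧ A) (eval-⟦⟧ B)
  eval-⟦⟧ (_ ∶ _)   = refl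
  eval-⟦⟧ (∀' _ _)  = refl
  eval-⟦⟧ (∃' _ _)  = refl

  tautology-true : ∀ A → Tautology A → ⟦ A ⟧ ≡ true
  tautology-true A τ = trans (sym (eval-⟦⟧ A)) (τ ⟦_⟧)

  -- Terms are invisible to ⟦_⟧, so substitution preserves the value;
  -- this is what makes the quantifier axioms Q1 and Q3 true.
  subst-invariant : ∀ t x A {B} → subst t x A ≡ just B → ⟦ B ⟧ ≡ ⟦ A ⟧
  subst-invariant t x (pv _) refl = refl
  subst-invariant t x δ refl = refl
  subst-invariant t x ⊥' refl = refl
  subst-invariant t x (¬' A) eq with subst t x A in eA
  ... | just _ with refl ← eq = cong not (subst-invariant t x A eA)
  subst-invariant t x (A ∧' B) eq with subst t x A in eA | subst t x B in eB
  ... | just _ | just _ with refl ← eq =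
    cong₂ _∧_ (subst-invariant t x A eA) (subst-invariant t x B eB)
  subst-invariant t x (A ∨' B) eq with subst t x A in eA | subst t x B in eB
  ... | just _ | just _ with refl ← eq =
    cong₂ _∨_ (subst-invariant t x A eA) (subst-invariant t x B eB)
  subst-invariant t x (A ⇒ B) eq with subst t x A in eA | subst t x B in eB
  ... | just _ | just _ with refl ← eq =
    cong₂ (λ a b → not a ∨ b) (subst-invariant t x A eA) (subst-invariant t x B eB)
  subst-invariant t x (s ∶ A) eq with substT t x s | subst t x A
  ... | just _ | just _ with refl ← eq = refl
  subst-invariant t x (∀' y A) eq with x ≡ᵇ y
  ... | true with refl ← eq = refl
  ... | false with subst t x A in eA
  ...   | just _ with refl ← eq = subst-invariant t x A eA
  subst-invariant t x (∃' y A) eq with x ≡ᵇ y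
  ... | true with refl ← eq = refl
  ... | false with subst t x A in eA
  ...   | just _ with refl ← eq = subst-invariant t x A eA

  -- Every axiom of QLP⁻ is true: the justification axioms vacuously,
  -- the quantifier axioms because they become instances of a → a.
  axiom-true : ∀ {A} → Axiom A → ⟦ A ⟧ ≡ true
  axiom-true {A} (taut τ) = tautology-true A τ
  axiom-true (Q1 {x} {A} {t} _ eq) rewrite subst-invariant t x A eq = ∨-inverseˡ ⟦ A ⟧
  axiom-true (Q2 {A = A} {B} _) = ∨-inverseˡ (not ⟦ A ⟧ ∨ ⟦ B ⟧)
  axiom-true (Q3 {x} {A} {t} _ eq) rewrite subst-invariant t x A eq = ∨-inverseˡ ⟦ A ⟧
  axiom-true (Q4 {A = A} {B} _) = ∨-inverseˡ (not ⟦ A ⟧ ∨ ⟦ B ⟧)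
  axiom-true jK = refl
  axiom-true jT = refl
  axiom-true j4 = refl
  axiom-true sumL = refl
  axiom-true sumR = refl

  modus-ponens-true : ∀ a b → not a ∨ b ≡ true → a ≡ true → b ≡ true
  modus-ponens-true true _ a⇒b refl = a⇒b

-- The extra axiom δ ↔ [E ∧ ¬(∃x)x:(δ → E)] is true whenever δ and E have
-- the same value, since (∃x)x:(δ → E) is false.
delta-axiom-true : ∀ ρ e x → Forgetful.⟦_⟧ ρ (ρ e) (deltaAxiom e x) ≡ true
delta-axiom-true ρ e x with ρ e
... | true  = refl
... | false = refl

sound : ∀ ρ {e x A} → Prov e x A → Forgetful.⟦_⟧ ρ (ρ e) A ≡ true
sound ρ {e} (ax a) = Forgetful.axiom-true ρ (ρ e) a
sound ρ {e} {x} extra = delta-axiom-true ρ e x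
sound ρ {e} (mp {A} {B} p q) =
  modus-ponens-true ⟦ A ⟧ ⟦ B ⟧ (sound ρ p) (sound ρ q)
  where open Forgetful ρ (ρ e)
sound ρ (gen _ p) = sound ρ p

-- Take every propositional variable (so E and δ) true: ¬δ is false there.
theorem28 : (e x : ℕ) → ¬ Prov e x (¬' δ)
theorem28 e x p with sound (λ _ → true) p
... | ()
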